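{- Let $q$ be an odd prime power, let $t\geq 1$ be an integer and $n=2t$, and let $h\in\mathbb{F}_{q^{2t}}$ satisfy $h^{q^t+1}=-1$. Then $h^{q^2+1}\neq 1$ and $h^{q^{t-2}}\neq -h$.
   Context: For $t=1$ the power $h^{q^{t-2}}=h^{q^{ -1}}$ is understood as the image of $h$ under the inverse of the Frobenius automorphism $x\mapsto x^q$ of $\mathbb{F}_{q^{2}}$. -}

module Defs where

open import Level using (Level; _⊔_)
open import Data.Nat using (ℕ; zero; suc; _^_; _≥_)
open import Data.Nat.Primality using (Prime)
open import Data.Fin using (Fin)
open import Data.Nat.Divisibility using (_∣_)
open import Data.Product using (Σ; ∃; _×_)
open import Relation.Nullary using (¬_)
open import Relation.Binary.PropositionalEquality using (_≡_)
import Relation.Binary.PropositionalEquality as ≡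
open import Function.Bundles using (Bijection)
open import Algebra.Bundles using (CommutativeRing)

IsOddPrimePower : ℕ → Set
IsOddPrimePower q =
  Σ ℕ λ p → Σ ℕ λ k → Prime p × (¬ (2 ∣ p)) × k ≥ 1 × q ≡ p ^ k

IsField : ∀ {c ℓ} → CommutativeRing c ℓ → Set (c ⊔ ℓ)
IsField R =
  (¬ (0# ≈ 1#)) × (∀ x → ¬ (x ≈ 0#) → ∃ λ y → x * y ≈ 1#)
  where open CommutativeRing R

HasCardinality : ∀ {c ℓ} → CommutativeRing c ℓ → ℕ → Set (c ⊔ ℓ)
HasCardinality R N = Bijection (CommutativeRing.setoid R) (≡.setoid (Fin N))

-- Exponent realising the map h ↦ h^{q^{t-2}} in F_{q^{2t}}.  For t = 1 the context defines h^{q^{-1}} as the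
-- image of h under the inverse of Frobenius x ↦ x^q of F_{q^2}; since
-- Frobenius has order 2 there, its inverse is x ↦ x^q, so the exponent is q.
-- (t = 0 is excluded by the hypothesis t ≥ 1; the value there is irrelevant.)
frobExp : ℕ → ℕ → ℕ
frobExp q zero = 1
frobExp q (suc zero) = q
frobExp q (suc (suc k)) = q ^ k

pow : ∀ {c ℓ} (R : CommutativeRing c ℓ) → CommutativeRing.Carrier R → ℕ → CommutativeRing.Carrier R
pow R = RS._^_ (Semiring.rawSemiring (CommutativeRing.semiring R))
  where import Algebra.Definitions.RawSemiring as RS
        open import Algebra.Bundles using (Semiring)

-- Since |F| = q^(2t) is odd, x ↦ x + 1 cannot be a fixed-point-free involution, so 1 ≠ -1 in F.
-- As q is odd, q^t + 1 is even, so h^(q^t+1) = -1 forbids h^e = 1 for every e twice an odd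
-- number: raising both to a common multiple would give 1 = -1.  Now q^2 + 1 is twice an odd
-- number.  If h^(q^(t-2)) = -h then, for t ≥ 2, raising to the odd power q^2 gives
-- h^(q^t) = -h^(q^2), hence h^(q^2+1) = 1; for t = 1 it gives h^(q+1) = -h^2, hence h^2 = 1.
module Submission where

open import Defs
open import Data.Product using (_×_)
open import Relation.Nullary using (¬_)
open import Algebra.Bundles using (CommutativeRing)
import Data.Nat as N

open import Algebra.Definitions using (Involutive)
open import Data.Nat using (ℕ; zero; suc)
open import Data.Nat.Divisibility using (_∣_; divides; ∣-refl; ∣m∣n⇒∣m+n)
open import Data.Fin using (Fin)
import Data.Fin.Permutation as Perm
open import Data.Product using (∃; _,_; proj₁)
open import Function using (_∘_)
open import Function.Bundles using (Bijection; Inverse)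
open import Function.Definitions using (Congruent)
open import Function.Properties.Bijection using (Bijection⇒Inverse)
open import Relation.Binary using (Setoid; tri<; tri≈; tri>)
open import Relation.Binary.PropositionalEquality as ≡ using (_≡_; _≢_)
open import Relation.Nullary using (yes; no; contradiction)

module Parity where
  open import Data.Nat using (_+_; _*_; _^_)
  open import Data.Nat.Properties using (even≢odd; *-comm)
  open import Data.Nat.Tactic.RingSolver using (solve-∀)

  Odd : ℕ → Set
  Odd n = ∃ λ k → n ≡ 1 + 2 * k

  odd⇒¬2∣ : ∀ {n} → Odd n → ¬ 2 ∣ n
  odd⇒¬2∣ (j , n≡1+2j) (divides k n≡k*2) =
    even≢odd k j (≡.trans (*-comm 2 k) (≡.trans (≡.sym n≡k*2) n≡1+2j))

  ¬2∣⇒odd : ∀ {n} → ¬ 2 ∣ n → Odd n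
  ¬2∣⇒odd {zero}        ¬2∣0   = contradiction (divides 0 ≡.refl) ¬2∣0
  ¬2∣⇒odd {suc zero}    _      = 0 , ≡.refl
  ¬2∣⇒odd {suc (suc n)} ¬2∣2+n with ¬2∣⇒odd (¬2∣2+n ∘ ∣m∣n⇒∣m+n ∣-refl)
  ... | k , ≡.refl = suc k , step k
    where
    step : ∀ k → 3 + 2 * k ≡ 1 + 2 * suc k
    step = solve-∀

  odd-* : ∀ {m n} → Odd m → Odd n → Odd (m * n)
  odd-* (a , ≡.refl) (b , ≡.refl) = a + b + 2 * a * b , product a b
    where
    product : ∀ a b → (1 + 2 * a) * (1 + 2 * b) ≡ 1 + 2 * (a + b + 2 * a * b)
    product = solve-∀

  odd-^ : ∀ {m} → Odd m → ∀ n → Odd (m ^ n)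
  odd-^ m-odd zero    = 0 , ≡.refl
  odd-^ m-odd (suc n) = odd-* m-odd (odd-^ m-odd n)

  odd⇒2∣n+1 : ∀ {n} → Odd n → 2 ∣ n + 1
  odd⇒2∣n+1 (k , ≡.refl) = divides (suc k) (successor k)
    where
    successor : ∀ k → 1 + 2 * k + 1 ≡ suc k * 2
    successor = solve-∀

  TwiceOdd : ℕ → Set
  TwiceOdd n = ∃ λ m → Odd m × n ≡ m * 2

  odd⇒twiceOdd[n²+1] : ∀ {n} → Odd n → TwiceOdd (n ^ 2 + 1)
  odd⇒twiceOdd[n²+1] (k , ≡.refl) = 1 + 2 * (k + k * k) , (k + k * k , ≡.refl) , square k
    where
    square : ∀ k → (1 + 2 * k) * ((1 + 2 * k) * 1) + 1 ≡ (1 + 2 * (k + k * k)) * 2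
    square = solve-∀

  oddPrimePower⇒odd : ∀ {q} → IsOddPrimePower q → Odd q
  oddPrimePower⇒odd (p , k , _ , ¬2∣p , _ , ≡.refl) = odd-^ (¬2∣⇒odd ¬2∣p) k

open Parity

module Involution where
  open import Data.Nat using (_+_; _*_)
  open import Data.Nat.Properties using (+-0-commutativeMonoid; +-identityʳ; *-comm)
  open import Data.Fin using (_<_)
  open import Data.Fin.Properties using (_<?_; <-asym; <-cmp)
  open import Algebra.Properties.CommutativeMonoid.Sum +-0-commutativeMonoid
    using (sum-syntax; ∑-distrib-+; ∑-permute; sum-cong-≗)
  open ≡.≡-Reasoning

  ∑-1≡n : ∀ n → ∑[ i < n ] 1 ≡ n
  ∑-1≡n zero    = ≡.refl
  ∑-1≡n (suc n) = ≡.cong suc (∑-1≡n n)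

  [_<ᶠ_] : ∀ {n} → Fin n → Fin n → ℕ
  [ i <ᶠ j ] with i <? j
  ... | yes _ = 1
  ... | no  _ = 0

  [<]+[>]≡1 : ∀ {n} {i j : Fin n} → i ≢ j → [ i <ᶠ j ] + [ j <ᶠ i ] ≡ 1
  [<]+[>]≡1 {i = i} {j} i≢j with i <? j | j <? i
  ... | yes i<j | yes j<i = contradiction j<i (<-asym i<j)
  ... | yes _   | no  _   = ≡.refl
  ... | no  _   | yes _   = ≡.refl
  ... | no  i≮j | no  j≮i with <-cmp i j
  ...   | tri< i<j _   _   = contradiction i<j i≮j
  ...   | tri≈ _   i≡j _   = contradiction i≡j i≢j
  ...   | tri> _   _   j<i = contradiction j<i j≮i

  -- Each pair {i, f i} is counted once, by its smaller element.
  fixedPointFreeInvolution⇒2∣n : ∀ {n} (f : Fin n → Fin n) → Involutive _≡_ f → (∀ i → f i ≢ i) → 2 ∣ n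
  fixedPointFreeInvolution⇒2∣n {n} f f-involutive f-fixedPointFree = divides pairs n≡pairs*2
    where
    leads : Fin n → ℕ
    leads i = [ i <ᶠ f i ]

    leads-pair : ∀ i → leads i + leads (f i) ≡ 1
    leads-pair i rewrite f-involutive i = [<]+[>]≡1 (f-fixedPointFree i ∘ ≡.sym)

    f-permutation : Perm.Permutation n n
    f-permutation = Perm.permutation f f f-involutive f-involutive

    pairs : ℕ
    pairs = ∑[ i < n ] leads i

    n≡pairs*2 : n ≡ pairs * 2
    n≡pairs*2 = begin
      n                                   ≡⟨ ∑-1≡n n ⟨
      ∑[ i < n ] 1                        ≡⟨ sum-cong-≗ (≡.sym ∘ leads-pair) ⟩
      ∑[ i < n ] (leads i + leads (f i))  ≡⟨ ∑-distrib-+ leads (leads ∘ f) ⟩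
      pairs + ∑[ i < n ] leads (f i)      ≡⟨ ≡.cong (pairs +_) (∑-permute leads f-permutation) ⟨
      pairs + pairs                       ≡⟨ ≡.cong (pairs +_) (+-identityʳ pairs) ⟨
      2 * pairs                           ≡⟨ *-comm 2 pairs ⟩
      pairs * 2                           ∎

  module _ {a ℓ} {S : Setoid a ℓ} {n} (S↔Fin : Bijection S (≡.setoid (Fin n))) where
    open Setoid S
    open Inverse (Bijection⇒Inverse S↔Fin)

    fixedPointFreeInvolution⇒2∣card : (σ : Carrier → Carrier) → Congruent _≈_ _≈_ σ →
      Involutive _≈_ σ → (∀ x → ¬ σ x ≈ x) → 2 ∣ n
    fixedPointFreeInvolution⇒2∣card σ σ-cong σ-involutive σ-fixedPointFree =
      fixedPointFreeInvolution⇒2∣n (to ∘ σ ∘ from) involutive fixedPointFree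
      where
      involutive : Involutive _≡_ (to ∘ σ ∘ from)
      involutive i = ≡.trans (to-cong (trans (σ-cong (strictlyInverseʳ _)) (σ-involutive (from i))))
                             (strictlyInverseˡ i)

      fixedPointFree : ∀ i → to (σ (from i)) ≢ i
      fixedPointFree i σi≡i =
        σ-fixedPointFree (from i) (trans (sym (strictlyInverseʳ _)) (from-cong σi≡i))

open Involution using (fixedPointFreeInvolution⇒2∣card)

module _ {c ℓ} (R : CommutativeRing c ℓ) where
  open CommutativeRing R
  open import Algebra.Properties.Ring ring using (+-identityʳ-unique)

  1≈-1⇒2∣card : ∀ {n} → ¬ 0# ≈ 1# → HasCardinality R n → 1# ≈ - 1# → 2 ∣ n
  1≈-1⇒2∣card 0≉1 card 1≈-1 =
    fixedPointFreeInvolution⇒2∣card card (_+ 1#) +-congʳ involutive fixedPointFree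
    where
    open import Relation.Binary.Reasoning.Setoid setoid

    involutive : Involutive _≈_ (_+ 1#)
    involutive x = begin
      x + 1# + 1#     ≈⟨ +-assoc x 1# 1# ⟩
      x + (1# + 1#)   ≈⟨ +-congˡ (+-congˡ 1≈-1) ⟩
      x + (1# - 1#)   ≈⟨ +-congˡ (-‿inverseʳ 1#) ⟩
      x + 0#          ≈⟨ +-identityʳ x ⟩
      x               ∎

    fixedPointFree : ∀ x → ¬ x + 1# ≈ x
    fixedPointFree x x+1≈x = 0≉1 (sym (+-identityʳ-unique x 1# x+1≈x))

module Powers {c ℓ} (R : CommutativeRing c ℓ) where
  open CommutativeRing R
  open import Algebra.Properties.Semiring.Exp semiring using (_^_; ^-congˡ; ^-congʳ; ^-homo-*; ^-assocʳ)
  open import Algebra.Properties.CommutativeSemiring.Exp commutativeSemiring using (^-distrib-*)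
  open import Algebra.Properties.Ring ring using (-1*x≈-x; -‿involutive; -‿distribˡ-*; -‿injective)
  import Data.Nat.Properties as ℕₚ
  open import Data.Nat.Tactic.RingSolver using (solve-∀)
  open import Relation.Binary.Reasoning.Setoid setoid

  1^n≈1 : ∀ n → 1# ^ n ≈ 1#
  1^n≈1 zero    = refl
  1^n≈1 (suc n) = trans (*-identityˡ _) (1^n≈1 n)

  [-1]²≈1 : (- 1#) ^ 2 ≈ 1#
  [-1]²≈1 = begin
    - 1# * (- 1# * 1#)  ≈⟨ *-congˡ (*-identityʳ (- 1#)) ⟩
    - 1# * - 1#         ≈⟨ -1*x≈-x (- 1#) ⟩
    - (- 1#)            ≈⟨ -‿involutive 1# ⟩
    1#                  ∎

  [-1]^odd≈-1 : ∀ {n} → Odd n → (- 1#) ^ n ≈ - 1#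
  [-1]^odd≈-1 (k , ≡.refl) = begin
    - 1# * (- 1#) ^ (2 N.* k)  ≈⟨ *-congˡ (^-assocʳ (- 1#) 2 k) ⟨
    - 1# * ((- 1#) ^ 2) ^ k    ≈⟨ *-congˡ (trans (^-congˡ k [-1]²≈1) (1^n≈1 k)) ⟩
    - 1# * 1#                  ≈⟨ *-identityʳ (- 1#) ⟩
    - 1#                       ∎

  [-x]^odd≈-x^odd : ∀ {n} x → Odd n → (- x) ^ n ≈ - (x ^ n)
  [-x]^odd≈-x^odd {n} x n-odd = begin
    (- x) ^ n             ≈⟨ ^-congˡ n (-1*x≈-x x) ⟨
    (- 1# * x) ^ n        ≈⟨ ^-distrib-* (- 1#) x n ⟩
    (- 1#) ^ n * x ^ n    ≈⟨ *-congʳ ([-1]^odd≈-1 n-odd) ⟩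
    - 1# * x ^ n          ≈⟨ -1*x≈-x (x ^ n) ⟩
    - (x ^ n)             ∎

  -- Raise x^e ≈ 1 and x^f ≈ -1 to the common multiple (m*2)*s = (s*2)*m.
  x^[twiceOdd]≉1 : ¬ 1# ≈ - 1# → ∀ {e f} {x} → 2 ∣ f → x ^ f ≈ - 1# → TwiceOdd e → ¬ x ^ e ≈ 1#
  x^[twiceOdd]≉1 1≉-1 {x = x} (divides s ≡.refl) x^f≈-1 (m , m-odd , ≡.refl) x^e≈1 = 1≉-1 (begin
    1#                      ≈⟨ 1^n≈1 s ⟨
    1# ^ s                  ≈⟨ ^-congˡ s x^e≈1 ⟨
    (x ^ (m N.* 2)) ^ s     ≈⟨ ^-assocʳ x (m N.* 2) s ⟩
    x ^ (m N.* 2 N.* s)     ≈⟨ ^-congʳ x (cross m s) ⟩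
    x ^ (s N.* 2 N.* m)     ≈⟨ ^-assocʳ x (s N.* 2) m ⟨
    (x ^ (s N.* 2)) ^ m     ≈⟨ ^-congˡ m x^f≈-1 ⟩
    (- 1#) ^ m              ≈⟨ [-1]^odd≈-1 m-odd ⟩
    - 1#                    ∎)
    where
    cross : ∀ m s → m N.* 2 N.* s ≡ s N.* 2 N.* m
    cross = solve-∀

  x^a≈-x⇒x^[a*b]≈-x^b : ∀ {a b} x → x ^ a ≈ - x → Odd b → x ^ (a N.* b) ≈ - (x ^ b)
  x^a≈-x⇒x^[a*b]≈-x^b {a} {b} x x^a≈-x b-odd = begin
    x ^ (a N.* b)  ≈⟨ ^-assocʳ x a b ⟨
    (x ^ a) ^ b    ≈⟨ ^-congˡ b x^a≈-x ⟩
    (- x) ^ b      ≈⟨ [-x]^odd≈-x^odd x b-odd ⟩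
    - (x ^ b)      ∎

  x^e≈-x^f⇒x^[e+1]≈-1⇒x^[f+1]≈1 : ∀ {e f} x → x ^ e ≈ - (x ^ f) →
    x ^ (e N.+ 1) ≈ - 1# → x ^ (f N.+ 1) ≈ 1#
  x^e≈-x^f⇒x^[e+1]≈-1⇒x^[f+1]≈1 {e} {f} x x^e≈-x^f x^[e+1]≈-1 = -‿injective (begin
    - (x ^ (f N.+ 1))    ≈⟨ -‿cong (^-homo-* x f 1) ⟩
    - (x ^ f * x ^ 1)    ≈⟨ -‿distribˡ-* (x ^ f) (x ^ 1) ⟩
    - (x ^ f) * x ^ 1    ≈⟨ *-congʳ x^e≈-x^f ⟨
    x ^ e * x ^ 1        ≈⟨ ^-homo-* x e 1 ⟨
    x ^ (e N.+ 1)        ≈⟨ x^[e+1]≈-1 ⟩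
    - 1#                 ∎)

  -- For t = 1 the hypothesis reads x^q ≈ -x; for t ≥ 2 it is raised to the odd power q^2.
  x^frobExp≈-x⇒x^[q^t]≈-x^f : ∀ {q t} x → Odd q → t N.≥ 1 → x ^ frobExp q t ≈ - x →
    ∃ λ f → TwiceOdd (f N.+ 1) × x ^ (q N.^ t) ≈ - (x ^ f)
  x^frobExp≈-x⇒x^[q^t]≈-x^f {q} {suc zero} x q-odd _ x^q≈-x =
    1 , (1 , (0 , ≡.refl) , ≡.refl) , x^a≈-x⇒x^[a*b]≈-x^b {a = q} x x^q≈-x (0 , ≡.refl)
  x^frobExp≈-x⇒x^[q^t]≈-x^f {q} {suc (suc k)} x q-odd _ x^[q^k]≈-x =
    q N.^ 2 , odd⇒twiceOdd[n²+1] q-odd , (begin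
      x ^ (q N.^ (2 N.+ k))       ≈⟨ ^-congʳ x (ℕₚ.^-distribˡ-+-* q 2 k) ⟩
      x ^ (q N.^ 2 N.* q N.^ k)   ≈⟨ ^-congʳ x (ℕₚ.*-comm (q N.^ 2) (q N.^ k)) ⟩
      x ^ (q N.^ k N.* q N.^ 2)   ≈⟨ x^a≈-x⇒x^[a*b]≈-x^b {a = q N.^ k} x x^[q^k]≈-x (odd-^ q-odd 2) ⟩
      - (x ^ (q N.^ 2))           ∎)

open import Data.Nat using (ℕ; _≥_; _+_)

proposition3p2 : ∀ {c ℓ} (q t : ℕ) → IsOddPrimePower q → t ≥ 1 →
    (F : CommutativeRing c ℓ) → IsField F → HasCardinality F (q N.^ (2 N.* t)) →
    (h : CommutativeRing.Carrier F) →
    CommutativeRing._≈_ F (pow F h (q N.^ t N.+ 1)) (CommutativeRing.-_ F (CommutativeRing.1# F)) →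
    (¬ CommutativeRing._≈_ F (pow F h (q N.^ 2 N.+ 1)) (CommutativeRing.1# F))
      × (¬ CommutativeRing._≈_ F (pow F h (frobExp q t)) (CommutativeRing.-_ F h))
proposition3p2 q t q-oddPrimePower t≥1 F F-field F-card h h^[q^t+1]≈-1 =
  h^[twiceOdd]≉1 (odd⇒twiceOdd[n²+1] q-odd) , h^frobExp≉-h
  where
  open CommutativeRing F using (_≈_; 1#; -_; semiring)
  open import Algebra.Properties.Semiring.Exp semiring using (_^_)
  open Powers F

  q-odd : Odd q
  q-odd = oddPrimePower⇒odd q-oddPrimePower

  1≉-1 : ¬ 1# ≈ - 1#
  1≉-1 = odd⇒¬2∣ (odd-^ q-odd (2 N.* t)) ∘ 1≈-1⇒2∣card F (proj₁ F-field) F-card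

  h^[twiceOdd]≉1 : ∀ {e} → TwiceOdd e → ¬ h ^ e ≈ 1#
  h^[twiceOdd]≉1 = x^[twiceOdd]≉1 1≉-1 (odd⇒2∣n+1 (odd-^ q-odd t)) h^[q^t+1]≈-1

  h^frobExp≉-h : ¬ h ^ frobExp q t ≈ - h
  h^frobExp≉-h h^frobExp≈-h with x^frobExp≈-x⇒x^[q^t]≈-x^f h q-odd t≥1 h^frobExp≈-h
  ... | f , twiceOdd[f+1] , h^[q^t]≈-h^f =
    h^[twiceOdd]≉1 twiceOdd[f+1]
      (x^e≈-x^f⇒x^[e+1]≈-1⇒x^[f+1]≈1 {e = q N.^ t} {f} h h^[q^t]≈-h^f h^[q^t+1]≈-1)
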